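{- Let $D$ be a diagram and $c$ a nonempty column of $D$. Then (i) for all $\tilde c<c$ and all $r$, $(r,\tilde c)\in\widehat D_c$ if and only if $(r,\tilde c)\in D$; (ii) for every $\tilde D\in\mathrm{KD}(D)$ with $\tilde D\preceq\widehat D_c$, every $\tilde c\ge c$ and every $r$, $(r,\tilde c)\in\tilde D$ if and only if $(r,\tilde c)\in\widehat D_c$; and (iii) the topmost cell in column $c$ of $\widehat D_c$ lies in row $h(D,c)$.
   Context: A diagram is a finite subset $D\subset\mathbb{Z}_{>0}\times\mathbb{Z}_{>0}$; $(r,c)\in D$ is a cell in row $r$, column $c$. Kohnert move at row $r$: if row $r$ is empty, $\mathcal{K}(D,r)=D$; otherwise let $(r,c)$ be the rightmost cell of row $r$; if some $r'<r$ has $(r',c)\notin D$, take the largest such $r'$ and set $\mathcal{K}(D,r)=(D\setminus\{(r,c)\})\cup\{(r',c)\}$; else $\mathcal{K}(D,r)=D$. $\mathrm{KD}(D)$ is the set of diagrams obtainable from $D$ by finite sequences of Kohnert moves, ordered by $D_2\preceq D_1$ iff $D_2$ is obtainable from $D_1$ by Kohnert moves. Let $c_1<\cdots<c_n$ be the nonempty columns of $D$ and $r_i$ the row of the topmost cell of column $c_i$ in $D$. Set $\widehat D_{c_{n+1}}=D$ and, for $i=n,n-1,\dots,1$, let $\widehat D_{c_i}$ be obtained from $\widehat D_{c_{i+1}}$ by applying one Kohnert move at each of the rows $r_i,r_i-1,\dots,1$ in this order (some moves may be trivial). For a nonempty column $c$ of $D$: let $m_c$ be the number of cells in column $c$, $M$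 the maximum number of cells in a column of $D$ strictly to the right of $c$ ($M=0$ if none), and $r$ the row of the topmost cell of column $c$ in $D$; define $h(D,c)=r$ if $M\ge r$, $h(D,c)=m_c$ if $m_c\ge M$, and $h(D,c)=M$ if $r>M>m_c$. -}

module Defs where

open import Data.Nat using (ℕ; zero; suc; _≤_; _<_; _⊔_; _∸_; _≟_; _≤?_; _<?_)
open import Data.Nat.Properties using () renaming (_≟_ to _≟ℕ_)
open import Data.Product using (_×_; _,_; proj₁; proj₂)
open import Data.Product.Properties using (≡-dec)
open import Data.List using (List; []; _∷_; map; filter; foldr; length; deduplicate; null)
open import Data.List.Membership.DecPropositional (≡-dec _≟ℕ_ _≟ℕ_) using (_∈?_)
open import Data.List.Membership.Propositional using (_∈_)
open import Data.List.Relation.Unary.All using (All)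
open import Data.Maybe using (Maybe; just; nothing)
open import Data.Bool using (Bool; true; false; if_then_else_)
open import Relation.Nullary using (does; ¬_; Dec; yes; no)
open import Relation.Binary.PropositionalEquality using (_≡_)

-- A cell (r , c) : row r, column c.  Rows are numbered 1,2,3,... from the
-- bottom; Kohnert moves move cells to lower rows.
Cell : Set
Cell = ℕ × ℕ

-- A diagram is a finite set of cells, represented by a list; only membership
-- is ever used, so duplicates / ordering in the list are irrelevant.
Diagram : Set
Diagram = List Cell

Valid : Diagram → Set
Valid D = All (λ x → (1 ≤ proj₁ x) × (1 ≤ proj₂ x)) D

maxList : List ℕ → ℕ
maxList = foldr _⊔_ 0

rowCols : Diagram → ℕ → List ℕ
rowCols D r = map proj₂ (filter (λ x → proj₁ x ≟ℕ r) D)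

colRows : Diagram → ℕ → List ℕ
colRows D c = map proj₁ (filter (λ x → proj₂ x ≟ℕ c) D)

findFree : ℕ → ℕ → Diagram → Maybe ℕ
findFree zero    c D = nothing
findFree (suc k) c D = if does ((suc k , c) ∈? D) then findFree k c D else just (suc k)

kohnert : Diagram → ℕ → Diagram
kohnert D r with null (rowCols D r)
... | true  = D
... | false with findFree (r ∸ 1) (maxList (rowCols D r)) D
...   | nothing = D
...   | just r' = (r' , maxList (rowCols D r)) ∷
                  filter (λ x → ¬? (≡-dec _≟ℕ_ _≟ℕ_ x (r , maxList (rowCols D r)))) D
  where
  ¬? : {P : Set} → Dec P → Dec (¬ P)
  ¬? (yes p) = no (λ q → q p)
  ¬? (no ¬p) = yes ¬p

data Reach : Diagram → Diagram → Set where
  done : ∀ {D} → Reach D D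
  step : ∀ {D E} (r : ℕ) → Reach (kohnert D r) E → Reach D E

_∈KD_ : Diagram → Diagram → Set
E ∈KD D = Reach D E

_⪯_ : Diagram → Diagram → Set
E ⪯ F = Reach F E

sweep : ℕ → Diagram → Diagram
sweep zero    E = E
sweep (suc k) E = sweep k (kohnert E (suc k))

NonemptyCol : Diagram → ℕ → Set
NonemptyCol D c = Data.Product.Σ ℕ (λ r → (r , c) ∈ D)

-- row of the topmost cell of column c in D (0 if empty)
topRow : Diagram → ℕ → ℕ
topRow D c = maxList (colRows D c)

colCount : Diagram → ℕ → ℕ
colCount D c = length (deduplicate _≟ℕ_ (colRows D c))

maxCol : Diagram → ℕ
maxCol D = maxList (map proj₂ D)

-- hatAux D n c : processes columns c+n-1, ..., c (from right to left),
-- starting from D; at each nonempty column c' apply the moves at rows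
-- r_{c'}, r_{c'}-1, ..., 1, with r_{c'} the top row of column c' in D.
hatAux : Diagram → ℕ → ℕ → Diagram
hatAux D zero    c = D
hatAux D (suc n) c with null (colRows D c)
... | true  = hatAux D n (suc c)
... | false = sweep (topRow D c) (hatAux D n (suc c))

hat : Diagram → ℕ → Diagram
hat D c = hatAux D (suc (maxCol D) ∸ c) c

maxRight : Diagram → ℕ → ℕ
maxRight D c = maxList (map (colCount D) (filter (λ c' → c <? c') (map proj₂ D)))

h : Diagram → ℕ → ℕ
h D c with maxRight D c | colCount D c | topRow D c
... | M | m | r = if does (r ≤? M) then r else (if does (M ≤? m) then m else M)

-- Call the columns ≥ c of a diagram frozen when every cell in such a column that is the rightmost
-- cell of its row has all the cells below it in its column. A Kohnert move at a row whose rightmost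
-- cell is in a frozen column is blocked, and any other move only changes a column < c; so frozen
-- columns never change again, which is (ii).
--
-- Processing the columns from right to left one keeps three facts: the columns < c are untouched
-- (this is (i)), the columns ≥ c are frozen, and the rows meeting columns ≥ c are exactly
-- 1, …, M_c, where M_c is the largest size of a column ≥ c. In the sweep of column c (moves at rows
-- r, …, 1, r the top row of column c, M = M_{c+1}) the rightmost cell of each row lies in a column
-- ≥ c, and only a cell in column c itself can move. If r ≤ M nothing moves. Otherwise the new top
-- row t of column c is at least M; if t > M no column right of c reaches row t, so column c ends up
-- as the full segment 1, …, m_c, and if t = M it ends at row M. This is the case distinction in
-- h(D, c).

{-# OPTIONS --safe #-}
module Submission where

open import Defs

open import Data.Bool using (true; false; if_then_else_)
open import Data.Empty using (⊥-elim)
open import Data.List using (List; []; _∷_; map; filter; length; deduplicate; null; applyUpTo)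
open import Data.List.Membership.Propositional using (_∈_; _∉_)
open import Data.List.Membership.Propositional.Properties
  using (∈-map⁺; ∈-map⁻; ∈-filter⁺; ∈-filter⁻; ∈-deduplicate⁺; ∈-deduplicate⁻;
         ∈-applyUpTo⁺; ∈-applyUpTo⁻)
open import Data.List.Membership.Propositional.Properties.WithK using (unique∧set⇒bag)
open import Data.List.Properties using (length-filter; length-applyUpTo)
open import Data.List.Relation.Binary.BagAndSetEquality using (∼bag⇒↭)
open import Data.List.Relation.Binary.Permutation.Propositional.Properties using (↭-length)
import Data.List.Relation.Unary.All as All
open import Data.List.Relation.Unary.All.Properties using (¬Any⇒All¬)
open import Data.List.Relation.Unary.Any using (here; there)
open import Data.List.Relation.Unary.Unique.Propositional using (Unique; _∷_)
open import Data.List.Relation.Unary.Unique.Propositional.Properties using (filter⁺; applyUpTo⁺₁)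
open import Data.List.Relation.Unary.Unique.DecPropositional.Properties using (deduplicate-!)
open import Data.Nat
  using (ℕ; zero; suc; _<_; _≤_; _+_; _⊔_; _∸_; z≤n; s≤s; s<s; _≟_; _≤?_; _<?_)
open import Data.Nat.Properties
open import Data.Maybe using (just; nothing)
open import Data.Maybe.Properties using (just-injective)
open import Data.Product as Product using (_×_; _,_; proj₁; proj₂; ∃-syntax)
open import Data.Product.Properties using (≡-dec; ,-injectiveˡ; ,-injectiveʳ)
open import Data.Sum as Sum using (_⊎_; inj₁; inj₂; [_,_]′)
open import Function using (_∘_; _∘₂_)
open import Function.Bundles using (_⇔_; mk⇔; Equivalence)
open import Relation.Binary.Definitions using (DecidableEquality)
open import Relation.Binary.PropositionalEquality
  using (_≡_; _≢_; refl; sym; trans; cong; subst; module ≡-Reasoning)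
open import Relation.Nullary using (¬_; yes; no; does)
open import Relation.Nullary.Decidable using (dec-true; dec-false)

open import Data.List.Membership.DecPropositional (≡-dec _≟_ _≟_) using (_∈?_)
open import Function.Properties.Equivalence
  using () renaming (refl to ⇔-refl; sym to ⇔-sym; trans to ⇔-trans)

open Equivalence using (to; from)

1≤_≤_ : ℕ → ℕ → Set
1≤ a ≤ t = 1 ≤ a × a ≤ t

≤-maxList : ∀ {x} xs → x ∈ xs → x ≤ maxList xs
≤-maxList (y ∷ ys) (here refl) = m≤m⊔n y (maxList ys)
≤-maxList (y ∷ ys) (there p)   = ≤-trans (≤-maxList ys p) (m≤n⊔m y (maxList ys))

maxList-least : ∀ {b} xs → (∀ {x} → x ∈ xs → x ≤ b) → maxList xs ≤ b
maxList-least []       _  = z≤n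
maxList-least (y ∷ ys) ub = ⊔-lub (ub (here refl)) (maxList-least ys (ub ∘ there))

maxList∷-∈ : ∀ y ys → maxList (y ∷ ys) ∈ y ∷ ys
maxList∷-∈ y []       = here (⊔-identityʳ y)
maxList∷-∈ y (z ∷ zs) with ⊔-sel y (maxList (z ∷ zs))
... | inj₁ y⊔m≡y = here y⊔m≡y
... | inj₂ y⊔m≡m = there (subst (_∈ z ∷ zs) (sym y⊔m≡m) (maxList∷-∈ z zs))

maxList-∈ : ∀ {x} xs → x ∈ xs → maxList xs ∈ xs
maxList-∈ (y ∷ ys) _ = maxList∷-∈ y ys

null≡true⇒∉ : ∀ {A : Set} {x : A} xs → null xs ≡ true → x ∉ xs
null≡true⇒∉ [] _ ()

null≡false⇒maxList-∈ : ∀ xs → null xs ≡ false → maxList xs ∈ xs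
null≡false⇒maxList-∈ (y ∷ ys) _ = maxList∷-∈ y ys

∈⇒null≡false : ∀ {A : Set} {x : A} xs → x ∈ xs → null xs ≡ false
∈⇒null≡false (_ ∷ _) _ = refl

module _ {A : Set} where

  unique-length-≡ : {xs ys : List A} → Unique xs → Unique ys →
                    (∀ {x} → x ∈ xs ⇔ x ∈ ys) → length xs ≡ length ys
  unique-length-≡ !xs !ys xs≈ys = ↭-length (∼bag⇒↭ (unique∧set⇒bag !xs !ys xs≈ys))

  module _ (_≟A_ : DecidableEquality A) where
    open import Data.List.Membership.DecPropositional _≟A_ using () renaming (_∈?_ to _∈A?_)

    unique-length-≤ : {xs ys : List A} → Unique xs → Unique ys →
                      (∀ {x} → x ∈ xs → x ∈ ys) → length xs ≤ length ys
    unique-length-≤ {xs} {ys} !xs !ys xs⊆ys = begin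
      length xs                     ≡⟨ unique-length-≡ !xs (filter⁺ (_∈A? xs) !ys) xs≈ys∩xs ⟩
      length (filter (_∈A? xs) ys)  ≤⟨ length-filter (_∈A? xs) ys ⟩
      length ys                     ∎
      where
      open ≤-Reasoning
      xs≈ys∩xs : ∀ {x} → x ∈ xs ⇔ x ∈ filter (_∈A? xs) ys
      xs≈ys∩xs = mk⇔ (λ p → ∈-filter⁺ (_∈A? xs) (xs⊆ys p) p)
                     (λ p → proj₂ (∈-filter⁻ (_∈A? xs) {xs = ys} p))

rows : ℕ → List ℕ
rows = applyUpTo suc

∈-rows : ∀ {t a} → a ∈ rows t ⇔ 1≤ a ≤ t
∈-rows = mk⇔ ∈-rows⁻ ∈-rows⁺
  where
  ∈-rows⁻ : ∀ {t a} → a ∈ rows t → 1≤ a ≤ t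
  ∈-rows⁻ p with ∈-applyUpTo⁻ suc p
  ... | _ , i<t , refl = s≤s z≤n , i<t
  ∈-rows⁺ : ∀ {t a} → 1≤ a ≤ t → a ∈ rows t
  ∈-rows⁺ {a = suc i} (_ , i<t) = ∈-applyUpTo⁺ suc i<t

rows-unique : ∀ t → Unique (rows t)
rows-unique t = applyUpTo⁺₁ suc t (λ i<j _ → <⇒≢ (s<s i<j))

∈-colRows⁺ : ∀ {E c i} → (i , c) ∈ E → i ∈ colRows E c
∈-colRows⁺ p = ∈-map⁺ proj₁ (∈-filter⁺ (λ x → proj₂ x ≟ _) p refl)

∈-colRows⁻ : ∀ E c {i} → i ∈ colRows E c → (i , c) ∈ E
∈-colRows⁻ E c p with ∈-map⁻ proj₁ p
... | (i , j) , q , refl with ∈-filter⁻ (λ x → proj₂ x ≟ c) q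
... | q′ , refl = q′

∈-rowCols⁺ : ∀ {E r j} → (r , j) ∈ E → j ∈ rowCols E r
∈-rowCols⁺ p = ∈-map⁺ proj₂ (∈-filter⁺ (λ x → proj₁ x ≟ _) p refl)

∈-rowCols⁻ : ∀ E r {j} → j ∈ rowCols E r → (r , j) ∈ E
∈-rowCols⁻ E r p with ∈-map⁻ proj₂ p
... | (i , j) , q , refl with ∈-filter⁻ (λ x → proj₁ x ≟ r) q
... | q′ , refl = q′

RowsPositive : Diagram → Set
RowsPositive E = ∀ {a j} → (a , j) ∈ E → 1 ≤ a

IsTop : Diagram → ℕ → ℕ → Set
IsTop E c t = (t , c) ∈ E × ((a : ℕ) → (a , c) ∈ E → a ≤ t)

topRow-isTop : ∀ {E c i} → (i , c) ∈ E → IsTop E c (topRow E c)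
topRow-isTop {E} {c} p =
  ∈-colRows⁻ E c (maxList-∈ (colRows E c) (∈-colRows⁺ p)) ,
  λ a q → ≤-maxList (colRows E c) (∈-colRows⁺ q)

colSet : Diagram → ℕ → List ℕ
colSet E c = deduplicate _≟_ (colRows E c)

∈-colSet : ∀ E c {i} → i ∈ colSet E c ⇔ (i , c) ∈ E
∈-colSet E c = mk⇔ (∈-colRows⁻ E c ∘ ∈-deduplicate⁻ _≟_ (colRows E c))
                   (∈-deduplicate⁺ _≟_ ∘ ∈-colRows⁺)

colSet-unique : ∀ E c → Unique (colSet E c)
colSet-unique E c = deduplicate-! _≟_ (colRows E c)

colCount-cong : ∀ E c E′ c′ → (∀ i → (i , c) ∈ E ⇔ (i , c′) ∈ E′) →
                colCount E c ≡ colCount E′ c′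
colCount-cong E c E′ c′ same = unique-length-≡ (colSet-unique E c) (colSet-unique E′ c′)
  (⇔-trans (∈-colSet E c) (⇔-trans (same _) (⇔-sym (∈-colSet E′ c′))))

colCount≤ : ∀ E c t → (∀ {i} → (i , c) ∈ E → 1≤ i ≤ t) → colCount E c ≤ t
colCount≤ E c t bounded = subst (colCount E c ≤_) (length-applyUpTo suc t)
  (unique-length-≤ _≟_ (colSet-unique E c) (rows-unique t)
                       (from ∈-rows ∘ bounded ∘ to (∈-colSet E c)))

colCount-full : ∀ E c t → (∀ i → (i , c) ∈ E ⇔ 1≤ i ≤ t) → colCount E c ≡ t
colCount-full E c t full = trans
  (unique-length-≡ (colSet-unique E c) (rows-unique t)
                   (⇔-trans (∈-colSet E c) (⇔-trans (full _) (⇔-sym ∈-rows))))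
  (length-applyUpTo suc t)

colCount-move : ∀ E E′ c {a a′} → (a , c) ∈ E → (a′ , c) ∉ E →
                (∀ i → (i , c) ∈ E′ ⇔ (i ≡ a′ ⊎ ((i , c) ∈ E × i ≢ a))) →
                colCount E′ c ≡ colCount E c
colCount-move E E′ c {a} {a′} a∈E a′∉E moved = suc-injective
  (unique-length-≡ (¬Any⇒All¬ _ a∉S′ ∷ colSet-unique E′ c) (¬Any⇒All¬ _ a′∉S ∷ colSet-unique E c)
                   (mk⇔ ⟶ ⟵))
  where
  a∉S′ : a ∉ colSet E′ c
  a∉S′ p with to (moved a) (to (∈-colSet E′ c) p)
  ... | inj₁ refl       = a′∉E a∈E
  ... | inj₂ (_ , a≢a) = a≢a refl
  a′∉S : a′ ∉ colSet E c
  a′∉S = a′∉E ∘ to (∈-colSet E c)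
  ⟶ : ∀ {z} → z ∈ a ∷ colSet E′ c → z ∈ a′ ∷ colSet E c
  ⟶ (here refl) = there (from (∈-colSet E c) a∈E)
  ⟶ (there p) with to (moved _) (to (∈-colSet E′ c) p)
  ... | inj₁ refl    = here refl
  ... | inj₂ (q , _) = there (from (∈-colSet E c) q)
  ⟵ : ∀ {z} → z ∈ a′ ∷ colSet E c → z ∈ a ∷ colSet E′ c
  ⟵ (here refl) = there (from (∈-colSet E′ c) (from (moved _) (inj₁ refl)))
  ⟵ {z} (there p) with z ≟ a
  ... | yes refl = here refl
  ... | no z≢a   =
    there (from (∈-colSet E′ c) (from (moved z) (inj₂ (to (∈-colSet E c) p , z≢a))))

-- Kohnert moves

findFree-nothing : ∀ k c E → findFree k c E ≡ nothing →
                   ∀ {i} → 1≤ i ≤ k → (i , c) ∈ E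
findFree-nothing zero    c E eq (1≤i , i≤0) = ⊥-elim (<⇒≱ 1≤i i≤0)
findFree-nothing (suc k) c E eq {i} (1≤i , i≤1+k) with (suc k , c) ∈? E
... | no _ with () ← eq
... | yes top with m≤n⇒m<n∨m≡n i≤1+k
...   | inj₂ refl = top
...   | inj₁ i≤k  = findFree-nothing k c E eq (1≤i , ≤-pred i≤k)

findFree-just : ∀ k c E {r′} → findFree k c E ≡ just r′ →
                1≤ r′ ≤ k × (r′ , c) ∉ E × (∀ {i} → r′ < i → i ≤ k → (i , c) ∈ E)
findFree-just zero    c E ()
findFree-just (suc k) c E {r′} eq with (suc k , c) ∈? E
... | no top∉E with refl ← just-injective eq =
  (s≤s z≤n , ≤-refl) , top∉E , λ r′<i i≤r′ → ⊥-elim (<⇒≱ r′<i i≤r′)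
... | yes top with findFree-just k c E eq
...   | (1≤r′ , r′≤k) , r′∉E , above =
  (1≤r′ , m≤n⇒m≤1+n r′≤k) , r′∉E , above′
  where
  above′ : ∀ {i} → r′ < i → i ≤ suc k → (i , c) ∈ E
  above′ r′<i i≤1+k with m≤n⇒m<n∨m≡n i≤1+k
  ... | inj₂ refl = top
  ... | inj₁ i≤k  = above r′<i (≤-pred i≤k)

Rightmost : Diagram → ℕ → ℕ → Set
Rightmost E i x = (i , x) ∈ E × (∀ {j} → x < j → (i , j) ∉ E)

Rightmost⇒≤ : ∀ {E i x j} → Rightmost E i x → (i , j) ∈ E → j ≤ x
Rightmost⇒≤ (_ , nothing-right) p = ≮⇒≥ (λ x<j → nothing-right x<j p)

Rightmost-unique : ∀ {E i x y} → Rightmost E i x → Rightmost E i y → x ≡ y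
Rightmost-unique rx ry = ≤-antisym (Rightmost⇒≤ ry (proj₁ rx)) (Rightmost⇒≤ rx (proj₁ ry))

FullBelow : Diagram → ℕ → ℕ → Set
FullBelow E i x = ∀ {i′} → 1 ≤ i′ → i′ < i → (i′ , x) ∈ E

MovesCell : Cell → Cell → Diagram → Diagram → Set
MovesCell old new E K = ∀ p → p ∈ K ⇔ (p ≡ new ⊎ (p ∈ E × p ≢ old))

MovesCell-otherColumn : ∀ {r r′ x E K a j} → MovesCell (r , x) (r′ , x) E K → j ≢ x →
                        (a , j) ∈ K ⇔ (a , j) ∈ E
MovesCell-otherColumn moved j≢x = mk⇔
  (λ p → [ (λ e → ⊥-elim (j≢x (,-injectiveʳ e))) , proj₁ ]′ (to (moved _) p))
  (λ p → from (moved _) (inj₂ (p , j≢x ∘ ,-injectiveʳ)))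

MovesCell-column : ∀ {r r′ x E K a} → MovesCell (r , x) (r′ , x) E K →
                   (a , x) ∈ K ⇔ (a ≡ r′ ⊎ ((a , x) ∈ E × a ≢ r))
MovesCell-column moved = mk⇔
  (Sum.map ,-injectiveˡ (Product.map₂ (λ a≢r → a≢r ∘ cong (_, _))) ∘ to (moved _))
  (from (moved _) ∘ Sum.map (cong (_, _)) (Product.map₂ (λ a≢r → a≢r ∘ ,-injectiveˡ)))

data KohnertView (E : Diagram) (r : ℕ) : Set where
  empty-row : (∀ {j} → (r , j) ∉ E) → kohnert E r ≡ E → KohnertView E r
  blocked   : ∀ x → Rightmost E r x → FullBelow E r x → kohnert E r ≡ E → KohnertView E r
  moves     : ∀ x r′ → Rightmost E r x → 1 ≤ r′ → r′ < r → (r′ , x) ∉ E →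
              (∀ {i} → r′ < i → i < r → (i , x) ∈ E) →
              MovesCell (r , x) (r′ , x) E (kohnert E r) → KohnertView E r

private
  kohnert-empty : ∀ E r → null (rowCols E r) ≡ true → kohnert E r ≡ E
  kohnert-empty E r eq with null (rowCols E r)
  kohnert-empty E r refl | true = refl

  kohnert-blocked : ∀ E r → null (rowCols E r) ≡ false →
                    findFree (r ∸ 1) (maxList (rowCols E r)) E ≡ nothing → kohnert E r ≡ E
  kohnert-blocked E r eq eq′ with null (rowCols E r)
  kohnert-blocked E r refl eq′ | false with findFree (r ∸ 1) (maxList (rowCols E r)) E
  kohnert-blocked E r refl refl | false | nothing = refl

  kohnert-moves : ∀ E r {r′} → null (rowCols E r) ≡ false →
                  findFree (r ∸ 1) (maxList (rowCols E r)) E ≡ just r′ →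
                  MovesCell (r , maxList (rowCols E r)) (r′ , maxList (rowCols E r)) E (kohnert E r)
  kohnert-moves E r eq eq′ p with null (rowCols E r)
  kohnert-moves E r refl eq′ p | false with findFree (r ∸ 1) (maxList (rowCols E r)) E
  kohnert-moves E r refl refl p | false | just _ = mk⇔
    (λ { (here p≡new) → inj₁ p≡new ; (there q) → inj₂ (∈-filter⁻ _ q) })
    (λ { (inj₁ p≡new)       → here p≡new
       ; (inj₂ (q , p≢old)) → there (∈-filter⁺ _ q p≢old) })

  rightmost-of-row : ∀ E r → null (rowCols E r) ≡ false → Rightmost E r (maxList (rowCols E r))
  rightmost-of-row E r nonempty =
    ∈-rowCols⁻ E r (null≡false⇒maxList-∈ (rowCols E r) nonempty) ,
    λ x<j p → <⇒≱ x<j (≤-maxList (rowCols E r) (∈-rowCols⁺ p))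

  <⇒≤∸1 : ∀ {i r} → i < r → i ≤ r ∸ 1
  <⇒≤∸1 (s≤s i≤r) = i≤r

  ≤∸1⇒< : ∀ {i r} → 1 ≤ i → i ≤ r ∸ 1 → i < r
  ≤∸1⇒< {r = zero}  1≤i i≤0 = ⊥-elim (<⇒≱ 1≤i i≤0)
  ≤∸1⇒< {r = suc _} _   i≤r = s≤s i≤r

kohnertView : ∀ E r → KohnertView E r
kohnertView E r with null (rowCols E r) in nonempty
... | true = empty-row (null≡true⇒∉ (rowCols E r) nonempty ∘ ∈-rowCols⁺)
                       (kohnert-empty E r nonempty)
... | false with findFree (r ∸ 1) (maxList (rowCols E r)) E in free
...   | nothing = blocked _ (rightmost-of-row E r nonempty)
                    (λ 1≤i i<r → findFree-nothing (r ∸ 1) _ E free (1≤i , <⇒≤∸1 i<r))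
                    (kohnert-blocked E r nonempty free)
...   | just r′ with findFree-just (r ∸ 1) _ E free
...     | (1≤r′ , r′≤r∸1) , r′∉E , above =
          moves _ r′ (rightmost-of-row E r nonempty) 1≤r′ (≤∸1⇒< 1≤r′ r′≤r∸1) r′∉E
                (λ r′<i i<r → above r′<i (<⇒≤∸1 i<r))
                (kohnert-moves E r nonempty free)

-- Frozen columns

Frozen : Diagram → ℕ → Set
Frozen E c = ∀ {i j} → c ≤ j → Rightmost E i j → FullBelow E i j

AgreeFrom : ℕ → Diagram → Diagram → Set
AgreeFrom c E E′ = ∀ {i j} → c ≤ j → (i , j) ∈ E ⇔ (i , j) ∈ E′

Frozen-resp : ∀ {c E E′} → AgreeFrom c E′ E → Frozen E c → Frozen E′ c
Frozen-resp {E = E} same frozen {i} {j} c≤j (ij∈E′ , nothing-right) =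
  from (same c≤j) ∘₂ frozen c≤j (to (same c≤j) ij∈E′ , nothing-right-in-E)
  where
  nothing-right-in-E : ∀ {j′} → j < j′ → (i , j′) ∉ E
  nothing-right-in-E j<j′ = nothing-right j<j′ ∘ from (same (≤-trans c≤j (<⇒≤ j<j′)))

-- A move at a row whose rightmost cell is in a column ≥ c is blocked; any other move only changes
-- the column of that rightmost cell.
kohnert-agreeFrom : ∀ {c E} → Frozen E c → ∀ r → AgreeFrom c (kohnert E r) E
kohnert-agreeFrom {c} {E} frozen r {j = j} c≤j with kohnertView E r
... | empty-row _ unchanged   rewrite unchanged = ⇔-refl
... | blocked _ _ _ unchanged rewrite unchanged = ⇔-refl
... | moves x r′ rightmost 1≤r′ r′<r r′∉E _ moved with c ≤? x
...   | yes c≤x = ⊥-elim (r′∉E (frozen c≤x rightmost 1≤r′ r′<r))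
...   | no c≰x  = MovesCell-otherColumn moved (λ { refl → c≰x c≤j })

kohnert-Frozen : ∀ {c E} → Frozen E c → ∀ r → Frozen (kohnert E r) c
kohnert-Frozen frozen r = Frozen-resp (kohnert-agreeFrom frozen r) frozen

Reach-agreeFrom : ∀ {c E F} → Frozen E c → Reach E F → AgreeFrom c F E
Reach-agreeFrom frozen done           c≤j = ⇔-refl
Reach-agreeFrom frozen (step r reach) c≤j =
  ⇔-trans (Reach-agreeFrom (kohnert-Frozen frozen r) reach c≤j) (kohnert-agreeFrom frozen r c≤j)

OccupiedRows : Diagram → ℕ → ℕ → Set
OccupiedRows F c T = ∀ {a} → 1≤ a ≤ T ⇔ (∃[ j ] c ≤ j × (a , j) ∈ F)

-- The sweep of one column

-- h D c reduces to hOf (maxRight D c) (colCount D c) (topRow D c).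
hOf : ℕ → ℕ → ℕ → ℕ
hOf M m r = if does (r ≤? M) then r else (if does (M ≤? m) then m else M)

hOf-low : ∀ {M m r} → r ≤ M → hOf M m r ≡ r
hOf-low {M} {m} {r} r≤M rewrite dec-true (r ≤? M) r≤M = refl

hOf-count : ∀ {M m r} → ¬ r ≤ M → M ≤ m → hOf M m r ≡ m
hOf-count {M} {m} {r} r≰M M≤m rewrite dec-false (r ≤? M) r≰M | dec-true (M ≤? m) M≤m = refl

hOf-cap : ∀ {M m r} → ¬ r ≤ M → m ≤ M → hOf M m r ≡ M
hOf-cap {M} {m} {r} r≰M m≤M with M ≤? m
... | yes M≤m = trans (hOf-count r≰M M≤m) (≤-antisym m≤M M≤m)
... | no  M≰m rewrite dec-false (r ≤? M) r≰M | dec-false (M ≤? m) M≰m = refl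

-- E is the diagram once the columns right of c have been processed, M the largest size of a column
-- right of c, and r the top row of column c.
module ColumnSweep {c M r : ℕ} {E : Diagram}
  (frozenE : Frozen E (suc c))
  (occupiedE : OccupiedRows E (suc c) M)
  (positiveE : RowsPositive E)
  (topE : IsTop E c r)
  where

  -- the state after the moves at rows r, r-1, …, i+1
  record Invariant (F : Diagram) (i : ℕ) : Set where
    field
      others    : ∀ {a j} → j ≢ c → (a , j) ∈ F ⇔ (a , j) ∈ E
      row-meets : 1 ≤ i → ∃[ j ] c ≤ j × (i , j) ∈ F
      settled   : ∀ {a} → i < a → Rightmost F a c → FullBelow F a c
      capped    : ∀ a → (a , c) ∈ F → a ≤ r
      positive  : RowsPositive F
      count     : colCount F c ≡ colCount E c
      fixed     : r ≤ M → ∀ {a} → (a , c) ∈ F ⇔ (a , c) ∈ E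
      high      : M < r → ∃[ a ] M ≤ a × (a , c) ∈ F
  open Invariant

  start : Invariant E r
  start = record
    { others    = λ _ → ⇔-refl
    ; row-meets = λ _ → c , ≤-refl , proj₁ topE
    ; settled   = λ r<a rightmost → ⊥-elim (<⇒≱ r<a (proj₂ topE _ (proj₁ rightmost)))
    ; capped    = proj₂ topE
    ; positive  = positiveE
    ; count     = refl
    ; fixed     = λ _ → ⇔-refl
    ; high      = λ M<r → r , <⇒≤ M<r , proj₁ topE
    }

  module _ {F i} (inv : Invariant F (suc i)) where

    rightmost-in-E : ∀ {a x} → c < x → Rightmost F a x → Rightmost E a x
    rightmost-in-E c<x (ax∈F , nothing-right) =
      to (others inv (>⇒≢ c<x)) ax∈F ,
      λ x<j p → nothing-right x<j (from (others inv (>⇒≢ (<-trans c<x x<j))) p)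

    c≤rightmost : ∀ {x} → Rightmost F (suc i) x → c ≤ x
    c≤rightmost rightmost with row-meets inv (s≤s z≤n)
    ... | j , c≤j , p = ≤-trans c≤j (Rightmost⇒≤ rightmost p)

    blocked-step : ∀ {x} → Rightmost F (suc i) x → FullBelow F (suc i) x → Invariant F i
    blocked-step {x} rightmost full = record
      { others = others inv ; capped = capped inv ; positive = positive inv
      ; count = count inv ; fixed = fixed inv ; high = high inv
      ; row-meets = λ 1≤i → x , c≤rightmost rightmost , full 1≤i ≤-refl
      ; settled = settled′
      }
      where
      settled′ : ∀ {a} → i < a → Rightmost F a c → FullBelow F a c
      settled′ i<a rightmost-c with m≤n⇒m<n∨m≡n i<a
      ... | inj₁ 1+i<a = settled inv 1+i<a rightmost-c
      ... | inj₂ refl  = subst (FullBelow F (suc i)) (Rightmost-unique rightmost rightmost-c) full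

    moving-column : ∀ {x r′} → Rightmost F (suc i) x → (r′ , x) ∉ F → 1 ≤ r′ → r′ < suc i →
                    x ≡ c
    moving-column rightmost r′∉F 1≤r′ r′<1+i with m≤n⇒m<n∨m≡n (c≤rightmost rightmost)
    ... | inj₂ c≡x = sym c≡x
    ... | inj₁ c<x = ⊥-elim (r′∉F (from (others inv (>⇒≢ c<x))
                       (frozenE c<x (rightmost-in-E c<x rightmost) 1≤r′ r′<1+i)))

    moves-step : ∀ {r′ K} → Rightmost F (suc i) c → 1 ≤ r′ → r′ < suc i →
                 (r′ , c) ∉ F → (∀ {a} → r′ < a → a < suc i → (a , c) ∈ F) →
                 MovesCell (suc i , c) (r′ , c) F K → Invariant K i
    moves-step {r′} {K} rightmost 1≤r′ r′<1+i r′∉F between moved = record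
      { others    = λ j≢c → ⇔-trans (MovesCell-otherColumn moved j≢c) (others inv j≢c)
      ; row-meets = λ _ → c , ≤-refl , ic∈K
      ; settled   = settled′
      ; capped    = capped′
      ; positive  = positive′
      ; count     = trans (colCount-move F K c (proj₁ rightmost) r′∉F (λ _ → column))
                          (count inv)
      ; fixed     = λ r≤M → ⊥-elim (<⇒≱ (s≤s M≤i) (≤-trans 1+i≤r r≤M))
      ; high      = λ _ → i , M≤i , ic∈K
      }
      where
      column : ∀ {a} → (a , c) ∈ K ⇔ (a ≡ r′ ⊎ ((a , c) ∈ F × a ≢ suc i))
      column = MovesCell-column moved

      1+i≤r : suc i ≤ r
      1+i≤r = capped inv _ (proj₁ rightmost)

      -- rows up to M meet a column right of c, but row i+1 has its rightmost cell in column c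
      M≤i : M ≤ i
      M≤i with suc i ≤? M
      ... | no  1+i≰M = ≤-pred (≰⇒> 1+i≰M)
      ... | yes 1+i≤M with to occupiedE (s≤s z≤n , 1+i≤M)
      ...   | j , c<j , p = ⊥-elim (proj₂ rightmost c<j (from (others inv (>⇒≢ c<j)) p))

      ic∈K : (i , c) ∈ K
      ic∈K with m≤n⇒m<n∨m≡n (≤-pred r′<1+i)
      ... | inj₂ refl = from column (inj₁ refl)
      ... | inj₁ r′<i = from column (inj₂ (between r′<i ≤-refl , <⇒≢ ≤-refl))

      -- a higher row with its rightmost cell in column c would force the free row r′ to be full
      settled′ : ∀ {a} → i < a → Rightmost K a c → FullBelow K a c
      settled′ {a} i<a (ac∈K , nothing-right) with to column ac∈K
      ... | inj₁ refl = ⊥-elim (<⇒≱ i<a (≤-pred r′<1+i))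
      ... | inj₂ (ac∈F , a≢1+i) =
        ⊥-elim (r′∉F (settled inv 1+i<a (ac∈F , nothing-right-in-F) 1≤r′ (<-trans r′<1+i 1+i<a)))
        where
        1+i<a : suc i < a
        1+i<a = ≤∧≢⇒< i<a (a≢1+i ∘ sym)
        nothing-right-in-F : ∀ {j} → c < j → (a , j) ∉ F
        nothing-right-in-F c<j p = nothing-right c<j (from (MovesCell-otherColumn moved (>⇒≢ c<j)) p)

      capped′ : ∀ a → (a , c) ∈ K → a ≤ r
      capped′ a p with to column p
      ... | inj₁ refl    = ≤-trans (<⇒≤ r′<1+i) 1+i≤r
      ... | inj₂ (q , _) = capped inv a q

      positive′ : RowsPositive K
      positive′ p with to (moved _) p
      ... | inj₁ refl    = 1≤r′
      ... | inj₂ (q , _) = positive inv q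

  sweep-step : ∀ {F i} → Invariant F (suc i) → Invariant (kohnert F (suc i)) i
  sweep-step {F} {i} inv with kohnertView F (suc i)
  ... | empty-row no-cell _ with row-meets inv (s≤s z≤n)
  ...   | _ , _ , p = ⊥-elim (no-cell p)
  sweep-step inv | blocked x rightmost full unchanged rewrite unchanged = blocked-step inv rightmost full
  sweep-step inv | moves x r′ rightmost 1≤r′ r′<1+i r′∉F between moved
    with refl ← moving-column inv rightmost r′∉F 1≤r′ r′<1+i =
    moves-step inv rightmost 1≤r′ r′<1+i r′∉F between moved

  sweep-invariant : ∀ k {F} → Invariant F k → Invariant (sweep k F) 0
  sweep-invariant zero    inv = inv
  sweep-invariant (suc k) inv = sweep-invariant k (sweep-step inv)

  swept : Diagram
  swept = sweep r E

  m : ℕ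
  m = colCount E c

  private
    final : Invariant swept 0
    final = sweep-invariant r start

  swept-others : ∀ {a j} → j ≢ c → (a , j) ∈ swept ⇔ (a , j) ∈ E
  swept-others = others final

  swept-positive : RowsPositive swept
  swept-positive = positive final

  swept-frozen : Frozen swept c
  swept-frozen c≤j rightmost with m≤n⇒m<n∨m≡n c≤j
  ... | inj₂ refl = settled final (positive final (proj₁ rightmost)) rightmost
  ... | inj₁ c<j  = Frozen-resp (λ c<j′ → others final (>⇒≢ c<j′)) frozenE c<j rightmost

  occupied-by : ∀ T → M ≤ T → (∀ a → (a , c) ∈ swept → a ≤ T) →
                (∀ {a} → M < a → a ≤ T → (a , c) ∈ swept) → OccupiedRows swept c T
  occupied-by T M≤T below above {a} = mk⇔ ⟶ ⟵
    where
    ⟶ : 1≤ a ≤ T → ∃[ j ] c ≤ j × (a , j) ∈ swept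
    ⟶ (1≤a , a≤T) with a ≤? M
    ... | no  a≰M = c , ≤-refl , above (≰⇒> a≰M) a≤T
    ... | yes a≤M with to occupiedE (1≤a , a≤M)
    ...   | j , c<j , p = j , <⇒≤ c<j , from (swept-others (>⇒≢ c<j)) p
    ⟵ : ∃[ j ] c ≤ j × (a , j) ∈ swept → 1≤ a ≤ T
    ⟵ (j , c≤j , p) with m≤n⇒m<n∨m≡n c≤j
    ... | inj₂ refl = positive final p , below a p
    ... | inj₁ c<j  = Product.map₂ (λ a≤M → ≤-trans a≤M M≤T)
                                   (from occupiedE (j , c<j , to (swept-others (>⇒≢ c<j)) p))

  occupied-up-to-M : (∀ a → (a , c) ∈ swept → a ≤ M) → OccupiedRows swept c M
  occupied-up-to-M below = occupied-by M ≤-refl below (λ M<a a≤M → ⊥-elim (<⇒≱ M<a a≤M))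

  Shape : ℕ → ℕ → Set
  Shape t T = IsTop swept c t × OccupiedRows swept c T

  m≤r : m ≤ r
  m≤r = colCount≤ E c r (λ p → positiveE p , proj₂ topE _ p)

  shape-low : r ≤ M → Shape (hOf M m r) (M ⊔ m)
  shape-low r≤M rewrite hOf-low {m = m} r≤M | m≥n⇒m⊔n≡m (≤-trans m≤r r≤M) =
    (from (fixed final r≤M) (proj₁ topE) , capped final) ,
    occupied-up-to-M (λ a p → ≤-trans (capped final a p) r≤M)

  module _ (M<r : M < r) where

    top : ℕ
    top = topRow swept c

    top-isTop : IsTop swept c top
    top-isTop with high final M<r
    ... | _ , _ , p = topRow-isTop p

    M≤top : M ≤ top
    M≤top with high final M<r
    ... | _ , M≤a , p = ≤-trans M≤a (proj₂ top-isTop _ p)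

    -- no column right of c reaches row top > M, so the top cell of column c is rightmost in its row
    module _ (M<top : M < top) where

      rightmost : Rightmost swept top c
      rightmost = proj₁ top-isTop , λ c<j p →
        <⇒≱ M<top (proj₂ (from occupiedE (_ , c<j , to (swept-others (>⇒≢ c<j)) p)))

      column-full : ∀ {a} → 1≤ a ≤ top → (a , c) ∈ swept
      column-full (1≤a , a≤top) with m≤n⇒m<n∨m≡n a≤top
      ... | inj₁ a<top = settled final (≤-<-trans z≤n M<top) rightmost 1≤a a<top
      ... | inj₂ refl  = proj₁ top-isTop

      top≡m : top ≡ m
      top≡m = trans (sym (colCount-full swept c top column)) (count final)
        where
        column : ∀ a → (a , c) ∈ swept ⇔ 1≤ a ≤ top
        column a = mk⇔ (λ p → positive final p , proj₂ top-isTop a p) column-full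

      M≤m : M ≤ m
      M≤m = subst (M ≤_) top≡m (<⇒≤ M<top)

      shape-full : Shape (hOf M m r) (M ⊔ m)
      shape-full rewrite hOf-count (<⇒≱ M<r) M≤m | m≤n⇒m⊔n≡n M≤m =
        subst (λ t → Shape t t) top≡m
              (top-isTop , occupied-by top M≤top (proj₂ top-isTop) above)
        where
        above : ∀ {a} → M < a → a ≤ top → (a , c) ∈ swept
        above M<a a≤top = column-full (≤-<-trans z≤n M<a , a≤top)

    module _ (top≤M : top ≤ M) where

      top≡M : top ≡ M
      top≡M = ≤-antisym top≤M M≤top

      m≤M : m ≤ M
      m≤M = subst (_≤ M) (count final)
        (colCount≤ swept c M (λ p → positive final p , ≤-trans (proj₂ top-isTop _ p) top≤M))

      shape-capped : Shape (hOf M m r) (M ⊔ m)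
      shape-capped rewrite hOf-cap (<⇒≱ M<r) m≤M | m≥n⇒m⊔n≡m m≤M =
        subst (IsTop swept c) top≡M top-isTop ,
        occupied-up-to-M (λ a p → ≤-trans (proj₂ top-isTop a p) top≤M)

  shape : Shape (hOf M m r) (M ⊔ m)
  shape with r ≤? M
  ... | yes r≤M = shape-low r≤M
  ... | no  r≰M with M <? topRow swept c
  ...   | yes M<top = shape-full (≰⇒> r≰M) M<top
  ...   | no  M≮top = shape-capped (≰⇒> r≰M) (≮⇒≥ M≮top)

-- Processing the columns from right to left

columns : Diagram → List ℕ
columns D = map proj₂ D

-- maxRight D c is maxGE D (suc c) by definition, as c <? c′ unfolds to suc c ≤? c′.
maxGE : Diagram → ℕ → ℕ
maxGE D c = maxList (map (colCount D) (filter (c ≤?_) (columns D)))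

colCount≤maxGE : ∀ D {c c′} → c′ ∈ columns D → c ≤ c′ → colCount D c′ ≤ maxGE D c
colCount≤maxGE D {c} p c≤c′ =
  ≤-maxList _ (∈-map⁺ (colCount D) (∈-filter⁺ (c ≤?_) p c≤c′))

maxGE-least : ∀ D {c b} → (∀ {c′} → c′ ∈ columns D → c ≤ c′ → colCount D c′ ≤ b) →
              maxGE D c ≤ b
maxGE-least D {c} {b} bound = maxList-least _ λ p → case (∈-map⁻ (colCount D) p)
  where
  case : ∀ {y} → ∃[ c′ ] c′ ∈ filter (c ≤?_) (columns D) × y ≡ colCount D c′ →
         y ≤ b
  case (c′ , q , refl) = let q′ , c≤c′ = ∈-filter⁻ (c ≤?_) q in bound q′ c≤c′

colCount-emptyColumn : ∀ D c → null (colRows D c) ≡ true → colCount D c ≡ 0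
colCount-emptyColumn D c empty =
  n≤0⇒n≡0 (colCount≤ D c 0 (⊥-elim ∘ null≡true⇒∉ (colRows D c) empty ∘ ∈-colRows⁺))

maxGE-suc : ∀ D c → maxGE D c ≡ maxGE D (suc c) ⊔ colCount D c
maxGE-suc D c = ≤-antisym
  (maxGE-least D λ {c′} p c≤c′ → case c′ p c≤c′)
  (⊔-lub (maxGE-least D λ p 1+c≤c′ → colCount≤maxGE D p (≤-trans (n≤1+n c) 1+c≤c′))
         own)
  where
  case : ∀ c′ → c′ ∈ columns D → c ≤ c′ →
         colCount D c′ ≤ maxGE D (suc c) ⊔ colCount D c
  case c′ p c≤c′ with m≤n⇒m<n∨m≡n c≤c′
  ... | inj₁ c<c′ = ≤-trans (colCount≤maxGE D p c<c′) (m≤m⊔n _ _)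
  ... | inj₂ refl = m≤n⊔m _ _
  own : colCount D c ≤ maxGE D c
  own with null (colRows D c) in empty
  ... | true  = ≤-trans (≤-reflexive (colCount-emptyColumn D c empty)) z≤n
  ... | false =
    colCount≤maxGE D (∈-map⁺ proj₂ (∈-colRows⁻ D c (null≡false⇒maxList-∈ _ empty))) ≤-refl

maxGE-beyond : ∀ D c → maxCol D < c → maxGE D c ≡ 0
maxGE-beyond D c maxCol<c = n≤0⇒n≡0 (maxGE-least D λ p c≤c′ →
  ⊥-elim (<⇒≱ (<-≤-trans maxCol<c c≤c′) (≤-maxList _ p)))

record HatInvariant (D F : Diagram) (c : ℕ) : Set where
  field
    left     : ∀ {a j} → j < c → (a , j) ∈ F ⇔ (a , j) ∈ D
    frozen   : Frozen F c
    occupied : OccupiedRows F c (maxGE D c)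
    positive : RowsPositive F
open HatInvariant

hatInvariant-beyond : ∀ {D c} → Valid D → maxCol D < c → HatInvariant D D c
hatInvariant-beyond {D} {c} valid maxCol<c = record
  { left     = λ _ → ⇔-refl
  ; frozen   = λ c≤j rightmost → ⊥-elim (beyond c≤j (proj₁ rightmost))
  ; occupied = mk⇔ (λ (1≤a , a≤M) → ⊥-elim (<⇒≱ 1≤a (subst (_ ≤_) (maxGE-beyond D c maxCol<c) a≤M)))
                   (λ (_ , c≤j , p) → ⊥-elim (beyond c≤j p))
  ; positive = λ p → proj₁ (All.lookup valid p)
  }
  where
  beyond : ∀ {i j} → c ≤ j → (i , j) ∉ D
  beyond c≤j p = <⇒≱ (<-≤-trans maxCol<c c≤j) (≤-maxList (columns D) (∈-map⁺ proj₂ p))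

hatInvariant-emptyColumn : ∀ {D F c} → null (colRows D c) ≡ true →
                           HatInvariant D F (suc c) → HatInvariant D F c
hatInvariant-emptyColumn {D} {F} {c} empty inv = record
  { left     = λ j<c → left inv (m<n⇒m<1+n j<c)
  ; frozen   = λ c≤j rightmost → frozen inv (1+c≤ c≤j (proj₁ rightmost)) rightmost
  ; occupied = subst (OccupiedRows F c) (sym maxGE-same) (⇔-trans (occupied inv) (mk⇔ widen narrow))
  ; positive = positive inv
  }
  where
  1+c≤ : ∀ {i j} → c ≤ j → (i , j) ∈ F → suc c ≤ j
  1+c≤ c≤j p with m≤n⇒m<n∨m≡n c≤j
  ... | inj₁ c<j = c<j
  ... | inj₂ refl =
    ⊥-elim (null≡true⇒∉ (colRows D c) empty (∈-colRows⁺ (to (left inv ≤-refl) p)))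
  widen : ∀ {a} → ∃[ j ] suc c ≤ j × (a , j) ∈ F → ∃[ j ] c ≤ j × (a , j) ∈ F
  widen (j , 1+c≤j , p) = j , ≤-trans (n≤1+n c) 1+c≤j , p
  narrow : ∀ {a} → ∃[ j ] c ≤ j × (a , j) ∈ F → ∃[ j ] suc c ≤ j × (a , j) ∈ F
  narrow (j , c≤j , p) = j , 1+c≤ c≤j p , p
  maxGE-same : maxGE D c ≡ maxGE D (suc c)
  maxGE-same = begin
    maxGE D c                       ≡⟨ maxGE-suc D c ⟩
    maxGE D (suc c) ⊔ colCount D c  ≡⟨ cong (maxGE D (suc c) ⊔_) (colCount-emptyColumn D c empty) ⟩
    maxGE D (suc c) ⊔ 0             ≡⟨ ⊔-identityʳ _ ⟩
    maxGE D (suc c)                 ∎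
    where open ≡-Reasoning

sweep-column : ∀ {D F c i} → (i , c) ∈ D → HatInvariant D F (suc c) →
               HatInvariant D (sweep (topRow D c) F) c × IsTop (sweep (topRow D c) F) c (h D c)
sweep-column {D} {F} {c} ic∈D inv =
  record { left     = left′
         ; frozen   = S.swept-frozen
         ; occupied = occupied′
         ; positive = S.swept-positive } ,
  subst (λ m → IsTop S.swept c (hOf (maxRight D c) m (topRow D c))) count (proj₁ S.shape)
  where
  same-column : ∀ {a} → (a , c) ∈ F ⇔ (a , c) ∈ D
  same-column = left inv ≤-refl
  topD : IsTop D c (topRow D c)
  topD = topRow-isTop ic∈D
  module S = ColumnSweep (frozen inv) (occupied inv) (positive inv)
               (from same-column (proj₁ topD) , λ a p → proj₂ topD a (to same-column p))
  count : colCount F c ≡ colCount D c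
  count = colCount-cong F c D c (λ _ → same-column)
  left′ : ∀ {a j} → j < c → (a , j) ∈ S.swept ⇔ (a , j) ∈ D
  left′ j<c = ⇔-trans (S.swept-others (<⇒≢ j<c)) (left inv (m<n⇒m<1+n j<c))
  occupied′ : OccupiedRows S.swept c (maxGE D c)
  occupied′ = subst (OccupiedRows S.swept c)
                    (trans (cong (maxGE D (suc c) ⊔_) count) (sym (maxGE-suc D c)))
                    (proj₂ S.shape)

hatAux-column : ∀ D n c → null (colRows D c) ≡ false →
                hatAux D (suc n) c ≡ sweep (topRow D c) (hatAux D n (suc c))
hatAux-column D n c nonempty with null (colRows D c)
hatAux-column D n c refl | false = refl

hatAux-invariant : ∀ {D} → Valid D → ∀ n c → maxCol D < c + n →
                   HatInvariant D (hatAux D n c) c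
hatAux-invariant valid zero c maxCol<c+0 =
  hatInvariant-beyond valid (subst (_ <_) (+-identityʳ c) maxCol<c+0)
hatAux-invariant {D} valid (suc n) c maxCol<c+1+n
  with hatAux-invariant valid n (suc c) (subst (maxCol D <_) (+-suc c n) maxCol<c+1+n)
     | null (colRows D c) in empty
... | inner | true  = hatInvariant-emptyColumn empty inner
... | inner | false =
  proj₁ (sweep-column (∈-colRows⁻ D c (null≡false⇒maxList-∈ _ empty)) inner)

hat-column : ∀ {D c i} → (i , c) ∈ D →
             hat D c ≡ sweep (topRow D c) (hatAux D (maxCol D ∸ c) (suc c))
hat-column {D} {c} ic∈D =
  trans (cong (λ n → hatAux D n c) (+-∸-assoc 1 c≤maxCol))
        (hatAux-column D (maxCol D ∸ c) c (∈⇒null≡false _ (∈-colRows⁺ ic∈D)))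
  where
  c≤maxCol : c ≤ maxCol D
  c≤maxCol = ≤-maxList (columns D) (∈-map⁺ proj₂ ic∈D)

hat-invariant : ∀ {D c} → Valid D → NonemptyCol D c →
                HatInvariant D (hat D c) c × IsTop (hat D c) c (h D c)
hat-invariant {D} {c} valid (i , ic∈D) =
  subst (λ H → HatInvariant D H c × IsTop H c (h D c)) (sym (hat-column ic∈D))
        (sweep-column ic∈D (hatAux-invariant valid (maxCol D ∸ c) (suc c) maxCol<1+c+k))
  where
  maxCol<1+c+k : maxCol D < suc c + (maxCol D ∸ c)
  maxCol<1+c+k = s≤s (m≤n+m∸n (maxCol D) c)

lemma4p4 : (D : Diagram) → Valid D → (c : ℕ) → NonemptyCol D c →
    ((c̃ r : ℕ) → c̃ < c → ((r , c̃) ∈ hat D c ⇔ (r , c̃) ∈ D))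
    × ((D̃ : Diagram) → D̃ ∈KD D → D̃ ⪯ hat D c → (c̃ r : ℕ) → c ≤ c̃ →
        ((r , c̃) ∈ D̃ ⇔ (r , c̃) ∈ hat D c))
    × (((h D c , c) ∈ hat D c) × ((r : ℕ) → (r , c) ∈ hat D c → r ≤ h D c))
lemma4p4 D valid c nonempty with hat-invariant valid nonempty
... | inv , top =
  (λ _ _ c̃<c → left inv c̃<c) ,
  (λ _ _ D̃⪯hat _ _ c≤c̃ → Reach-agreeFrom (frozen inv) D̃⪯hat c≤c̃) ,
  top
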